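{- Let $G$ be a connected cactus graph. Let $e_1$ be an edge of $G$ that is either a bridge or lies in an even cycle, and let $e_2\in E_{\mathsf{rem}}$. Then every very strong rainbow coloring of $G$ colors $e_1$ and $e_2$ with different colors.
   Context: All graphs are finite, simple and undirected. A cactus graph is a graph in which every edge belongs to at most one cycle; a bridge is an edge in no cycle. For an edge $e$ of an odd cycle $C$ of $G$, the opposite vertex $\mathsf{vopp}(e)$ is the unique vertex of $C$ equidistant (in $G$) from both endpoints of $e$. $E_{\mathsf{rem}}$ is the set of edges $e$ lying in an odd cycle such that $\mathsf{vopp}(e)$ has degree exactly $2$ in $G$. A very strong rainbow coloring of $G$ is a coloring of $E(G)$ such that for every pair of vertices and every shortest path between them, all edges of that path receive pairwise different colors. -}

module Defs where

open import Data.Nat using (ℕ; zero; suc; _+_; _*_; _≤_; _<_; NonZero)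
open import Data.Nat.DivMod using (_%_; m%n<n)
open import Data.Fin using (Fin; toℕ; fromℕ; fromℕ<; inject₁) renaming (zero to fzero; suc to fsuc)
open import Data.Bool using (Bool; true; false)
open import Data.List using (List; length; filterᵇ)
open import Data.List using () renaming (allFin to allFinL)
open import Data.Product using (Σ; ∃; ∃-syntax; _×_; _,_)
open import Data.Sum using (_⊎_)
open import Function using (Injective)
open import Relation.Binary.PropositionalEquality using (_≡_; _≢_)
open import Relation.Nullary using (¬_)

record Graph (n : ℕ) : Set where
  field
    adj    : Fin n → Fin n → Bool
    sym    : ∀ u v → adj u v ≡ adj v u
    irrefl : ∀ u → adj u u ≡ false

module _ {n : ℕ} (G : Graph n) where
  open Graph G

  Adj : Fin n → Fin n → Set
  Adj u v = adj u v ≡ true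

  deg : Fin n → ℕ
  deg v = length (filterᵇ (adj v) (allFinL n))

  record Walk (u v : Fin n) (k : ℕ) : Set where
    field
      vtx   : Fin (suc k) → Fin n
      start : vtx fzero ≡ u
      end   : vtx (fromℕ k) ≡ v
      step  : (i : Fin k) → Adj (vtx (inject₁ i)) (vtx (fsuc i))

  Dist : Fin n → Fin n → ℕ → Set
  Dist u v d = Walk u v d × (∀ k → Walk u v k → d ≤ k)

  Connected : Set
  Connected = ∀ u v → ∃[ k ] Walk u v k

  next : {m : ℕ} → Fin (suc m) → Fin (suc m)
  next {m} i = fromℕ< (m%n<n (suc (toℕ i)) (suc m))

  record Cycle : Set where
    field
      k     : ℕ
      cyc   : Fin (3 + k) → Fin n
      inj   : Injective _≡_ _≡_ cyc
      adjC  : (i : Fin (3 + k)) → Adj (cyc i) (cyc (next i))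

  open Cycle

  len : Cycle → ℕ
  len C = 3 + k C

  Odd : ℕ → Set
  Odd m = ∃[ j ] m ≡ suc (2 * j)


  Even : ℕ → Set
  Even m = ∃[ j ] m ≡ 2 * j


  EdgeOf : Cycle → Fin n → Fin n → Set
  EdgeOf C a b = ∃[ i ] ((cyc C i ≡ a × cyc C (next i) ≡ b)
                        ⊎ (cyc C i ≡ b × cyc C (next i) ≡ a))

  OnCycle : Cycle → Fin n → Set
  OnCycle C w = ∃[ i ] cyc C i ≡ w

  SameCycle : Cycle → Cycle → Set
  SameCycle C D = ∀ a b → (EdgeOf C a b → EdgeOf D a b) × (EdgeOf D a b → EdgeOf C a b)

  Cactus : Set
  Cactus = ∀ a b → Adj a b → ∀ C D → EdgeOf C a b → EdgeOf D a b → SameCycle C D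

  Bridge : Fin n → Fin n → Set
  Bridge a b = Adj a b × (∀ C → ¬ EdgeOf C a b)

  InEvenCycle : Fin n → Fin n → Set
  InEvenCycle a b = Adj a b × ∃[ C ] (Even (len C) × EdgeOf C a b)

  Equidistant : Fin n → Fin n → Fin n → Set
  Equidistant w a b = ∃[ d ] (Dist w a d × Dist w b d)

  IsVopp : Cycle → Fin n → Fin n → Fin n → Set
  IsVopp C a b w = OnCycle C w × Equidistant w a b
                   × (∀ w' → OnCycle C w' → Equidistant w' a b → w' ≡ w)

  Erem : Fin n → Fin n → Set
  Erem a b = Adj a b × ∃[ C ] (Odd (len C) × EdgeOf C a b
                               × ∃[ w ] (IsVopp C a b w × deg w ≡ 2))

  -- edge colouring: a symmetric function on pairs (only values on edges matter)
  record EdgeColoring (Col : Set) : Set where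
    field
      col    : Fin n → Fin n → Col
      colSym : ∀ u v → col u v ≡ col v u

  VeryStrongRainbow : {Col : Set} → EdgeColoring Col → Set
  VeryStrongRainbow c = ∀ u v d → Dist u v d → (p : Walk u v d) →
    ∀ (i j : Fin d) → i ≢ j →
      EdgeColoring.col c (Walk.vtx p (inject₁ i)) (Walk.vtx p (fsuc i))
        ≢ EdgeColoring.col c (Walk.vtx p (inject₁ j)) (Walk.vtx p (fsuc j))

-- Let ab lie on the odd cycle C whose vertex w opposite ab has degree 2, and let pq
-- lie on no odd cycle (a bridge does not, and in a cactus neither does an edge of an
-- even cycle). Two geodesics of equal length from z to a and to b, followed back to
-- their last common vertex, close up with ab into an odd cycle, which in a cactus is C;
-- as w has degree 2 that common vertex is z itself, so w is the only vertex equidistant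
-- from a and b. Likewise p and q are never equidistant from a vertex. With p one step
-- farther from a than q, comparing distances to b leaves three cases: some geodesic
-- runs p q … a b or p q … b a, so the two edges get different colours; p and q are
-- both equidistant from a and b, hence both equal w; or d(p,b) = d(q,a) = d(p,a) - 1
-- = d(q,b) - 1, and then the geodesics p…b and q…a close up with ab and pq into a
-- cycle through ab, i.e. C, which is odd.

module Submission where

open import Defs
open import Data.Bool using (true; T)
open import Data.Bool.Properties using () renaming (_≟_ to _≟ᵇ_)
open import Data.Empty using (⊥; ⊥-elim)
open import Data.Fin using (Fin; toℕ; fromℕ; fromℕ<; inject₁; _≟_) renaming (zero to fzero; suc to fsuc)
open import Data.Fin.Properties using (any?; injective⇒≤; toℕ-fromℕ; toℕ-fromℕ<; fromℕ<-toℕ; toℕ-inject₁; toℕ<n; toℕ-injective)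
open import Data.List using (List; []; _∷_; length; filterᵇ; allFin)
open import Data.List.Membership.Propositional using (_∈_)
open import Data.List.Membership.Propositional.Properties using (∈-filter⁺; ∈-allFin)
open import Data.List.Relation.Unary.Any using (here; there)
open import Data.Nat using (ℕ; zero; suc; _+_; _*_; _∸_; _≤_; _<_; z≤n; s≤s; s≤s⁻¹)
open import Data.Nat.DivMod using (_%_; m%n<n; m<n⇒m%n≡m; n%n≡0)
open import Data.Nat.Induction using (<-rec)
open import Data.Nat.Properties hiding (_≟_)
open import Data.Nat.Tactic.RingSolver using (solve-∀)
open import Data.Product using (∃-syntax; _×_; _,_; proj₁; proj₂)
open import Data.Sum using (_⊎_; inj₁; inj₂; [_,_]′)
open import Data.Unit using (tt)
open import Function using (_∘_)
open import Relation.Binary.Definitions using (tri<; tri≈; tri>)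
open import Relation.Binary.PropositionalEquality
open import Relation.Nullary using (¬_; Dec; yes; no; contradiction)
open import Relation.Nullary.Decidable using (_×-dec_; T?)
import Relation.Unary as U

∈-pair : ∀ {A : Set} {x a b : A} → x ∈ a ∷ b ∷ [] → x ≡ a ⊎ x ≡ b
∈-pair (here x≡a)         = inj₁ x≡a
∈-pair (there (here x≡b)) = inj₂ x≡b

length≡2⇒¬3-distinct : ∀ {A : Set} {xs : List A} {x y z} → length xs ≡ 2 → x ∈ xs → y ∈ xs → z ∈ xs →
                       x ≢ y → x ≢ z → y ≢ z → ⊥
length≡2⇒¬3-distinct {xs = _ ∷ _ ∷ []} _ x∈ y∈ z∈ x≢y x≢z y≢z with ∈-pair x∈ | ∈-pair y∈ | ∈-pair z∈
... | inj₁ refl | inj₁ refl | _         = x≢y refl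
... | inj₂ refl | inj₂ refl | _         = x≢y refl
... | inj₁ refl | inj₂ refl | inj₁ refl = x≢z refl
... | inj₁ refl | inj₂ refl | inj₂ refl = y≢z refl
... | inj₂ refl | inj₁ refl | inj₁ refl = y≢z refl
... | inj₂ refl | inj₁ refl | inj₂ refl = x≢z refl

greatest≤ : (R : ℕ → Set) → U.Decidable R → R 0 → ∀ m →
            ∃[ k ] (k ≤ m × R k × (∀ {i} → k < i → i ≤ m → ¬ R i))
greatest≤ R R? R0 zero = 0 , z≤n , R0 , λ 0<i i≤0 → contradiction i≤0 (<⇒≱ 0<i)
greatest≤ R R? R0 (suc m) with R? (suc m)
... | yes Rm = suc m , ≤-refl , Rm , λ m<i i≤m → contradiction i≤m (<⇒≱ m<i)
... | no ¬Rm with greatest≤ R R? R0 m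
...   | k , k≤m , Rk , above = k , m≤n⇒m≤1+n k≤m , Rk , above′
  where
  above′ : ∀ {i} → k < i → i ≤ suc m → ¬ R i
  above′ k<i i≤1+m with m≤n⇒m<n∨m≡n i≤1+m
  ... | inj₁ i<1+m = above k<i (s≤s⁻¹ i<1+m)
  ... | inj₂ refl  = ¬Rm

within-one : ∀ {x y} → x ≤ suc y → y ≤ suc x → x ≡ suc y ⊎ x ≡ y ⊎ y ≡ suc x
within-one {x} {y} x≤1+y y≤1+x with <-cmp x y
... | tri< x<y _ _ = inj₂ (inj₂ (≤-antisym y≤1+x x<y))
... | tri≈ _ x≡y _ = inj₂ (inj₁ x≡y)
... | tri> _ _ y<x = inj₁ (≤-antisym x≤1+y y<x)

¬-both-detours : ∀ {α i j i′ j′} → i + i′ ≡ α → j + j′ ≡ α → suc α ≤ i + j′ → suc α ≤ j + i′ → ⊥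
¬-both-detours {i = i} {j} {i′} {j′} i+i′≡α j+j′≡α α<i+j′ α<j+i′ with ≤-total i j
... | inj₁ i≤j = 1+n≰n (≤-trans α<i+j′ (≤-trans (+-monoˡ-≤ j′ i≤j) (≤-reflexive j+j′≡α)))
... | inj₂ j≤i = 1+n≰n (≤-trans α<j+i′ (≤-trans (+-monoˡ-≤ i′ j≤i) (≤-reflexive i+i′≡α)))

module _ {n : ℕ} (G : Graph n) where

  infix 4 _~_
  _~_ : Fin n → Fin n → Set
  _~_ = Adj G

  ~-sym : ∀ {u v} → u ~ v → v ~ u
  ~-sym {u} {v} u~v = trans (Graph.sym G v u) u~v

  ~-irrefl : ∀ {u v} → u ~ v → u ≢ v
  ~-irrefl {u} u~u refl with trans (sym u~u) (Graph.irrefl G u)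
  ... | ()

  -- Walk with vertices indexed by ℕ instead of Fin (suc k) (values past the
  -- end are irrelevant), so that walks can be cut and joined without Fin arithmetic.
  record Walk′ (u v : Fin n) (k : ℕ) : Set where
    field
      vtx   : ℕ → Fin n
      start : vtx 0 ≡ u
      end   : vtx k ≡ v
      step  : ∀ i → i < k → vtx i ~ vtx (suc i)
  open Walk′ public

  ε : ∀ {u} → Walk′ u u 0
  ε {u} = record { vtx = λ _ → u ; start = refl ; end = refl ; step = λ _ () }

  infixr 5 _◅_ _++_
  infixl 5 _▻_

  _◅_ : ∀ {u v w k} → u ~ v → Walk′ v w k → Walk′ u w (suc k)
  _◅_ {u} u~v W = record
    { vtx   = λ { zero → u ; (suc i) → vtx W i }
    ; start = refl
    ; end   = end W
    ; step  = λ { zero _ → subst (u ~_) (sym (start W)) u~v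
                ; (suc i) (s≤s i<k) → step W i i<k } }

  tail : ∀ {u v k} (W : Walk′ u v (suc k)) → Walk′ (vtx W 1) v k
  tail W = record { vtx = vtx W ∘ suc ; start = refl ; end = end W
                  ; step = λ i i<k → step W (suc i) (s≤s i<k) }

  head : ∀ {u v k} (W : Walk′ u v (suc k)) → u ~ vtx W 1
  head W = subst (_~ vtx W 1) (start W) (step W 0 (s≤s z≤n))

  startAt : ∀ {u u′ v k} → u′ ≡ u → Walk′ u v k → Walk′ u′ v k
  startAt u′≡u W = record { vtx = vtx W ; start = trans (start W) (sym u′≡u) ; end = end W ; step = step W }

  cast : ∀ {u v k l} → k ≡ l → Walk′ u v k → Walk′ u v l
  cast {v = v} k≡l W = record
    { vtx   = vtx W
    ; start = start W
    ; end   = subst (λ j → vtx W j ≡ v) k≡l (end W)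
    ; step  = λ i i<l → step W i (subst (i <_) (sym k≡l) i<l) }

  _++_ : ∀ {u v w k l} → Walk′ u v k → Walk′ v w l → Walk′ u w (k + l)
  _++_ {k = zero}  W V = startAt (trans (sym (start W)) (end W)) V
  _++_ {k = suc k} W V = head W ◅ (tail W ++ V)

  ++-vtxˡ : ∀ {u v w k l} (W : Walk′ u v k) (V : Walk′ v w l) i → i ≤ k → vtx (W ++ V) i ≡ vtx W i
  ++-vtxˡ {k = zero}  W V zero    _         = trans (start V) (sym (end W))
  ++-vtxˡ {k = suc k} W V zero    _         = sym (start W)
  ++-vtxˡ {k = suc k} W V (suc i) (s≤s i≤k) = ++-vtxˡ (tail W) V i i≤k

  _▻_ : ∀ {u v w k} → Walk′ u v k → v ~ w → Walk′ u w (suc k)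
  _▻_ {k = k} W v~w = cast (+-comm k 1) (W ++ v~w ◅ ε)

  reverse : ∀ {u v k} → Walk′ u v k → Walk′ v u k
  reverse {k = zero}  W = startAt (trans (sym (end W)) (start W)) ε
  reverse {k = suc k} W = reverse (tail W) ▻ ~-sym (head W)

  take : ∀ {u v k} i → i ≤ k → (W : Walk′ u v k) → Walk′ u (vtx W i) i
  take i i≤k W = record { vtx = vtx W ; start = start W ; end = refl
                        ; step = λ j j<i → step W j (≤-trans j<i i≤k) }

  drop : ∀ {u v k} i {l} → i + l ≡ k → (W : Walk′ u v k) → Walk′ (vtx W i) v l
  drop i {l} i+l≡k W = record
    { vtx   = λ j → vtx W (i + j)
    ; start = cong (vtx W) (+-identityʳ i)
    ; end   = trans (cong (vtx W) i+l≡k) (end W)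
    ; step  = λ j j<l → subst (λ x → vtx W (i + j) ~ vtx W x) (sym (+-suc i j))
                          (step W (i + j) (subst₂ _≤_ (+-suc i j) i+l≡k (+-monoʳ-≤ i j<l))) }

  walk? : ∀ u v k → Dec (Walk′ u v k)
  walk? u v zero with u ≟ v
  ... | yes refl = yes ε
  ... | no u≢v   = no λ W → u≢v (trans (sym (start W)) (end W))
  walk? u v (suc k) with any? (λ t → walk? u t k ×-dec (Graph.adj G t v ≟ᵇ true))
  ... | yes (t , W , t~v) = yes (W ▻ t~v)
  ... | no ∄t             = no λ W → ∄t (vtx W k , take k (n≤1+n k) W
                                       , subst (vtx W k ~_) (end W) (step W k ≤-refl))

  record Geodesic (u v : Fin n) (d : ℕ) : Set where
    field
      walk     : Walk′ u v d
      shortest : ∀ {l} → Walk′ u v l → d ≤ l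
  open Geodesic public

  geodesic-exists : ∀ {u v} k → Walk′ u v k → ∃[ d ] Geodesic u v d
  geodesic-exists {u} {v} = <-rec _ shorten
    where
    shorten : ∀ k → (∀ {l} → l < k → Walk′ u v l → ∃[ d ] Geodesic u v d) → Walk′ u v k → ∃[ d ] Geodesic u v d
    shorten k rec W with anyUpTo? (walk? u v) k
    ... | yes (l , l<k , V) = rec l<k V
    ... | no ∄l = k , record { walk = W ; shortest = λ {l} V → ≮⇒≥ (λ l<k → ∄l (l , l<k , V)) }

  geodesic-length-unique : ∀ {u v d d′} → Geodesic u v d → Geodesic u v d′ → d ≡ d′
  geodesic-length-unique P Q = ≤-antisym (shortest P (walk Q)) (shortest Q (walk P))

  geodesic-reverse : ∀ {u v d} → Geodesic u v d → Geodesic v u d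
  geodesic-reverse P = record { walk = reverse (walk P) ; shortest = shortest P ∘ reverse }

  geodesic-take : ∀ {u v d} (P : Geodesic u v d) i → i ≤ d → Geodesic u (vtx (walk P) i) i
  geodesic-take P i i≤d = record { walk = take i i≤d (walk P) ; shortest = λ {l} R →
    +-cancelʳ-≤ r i l (subst (_≤ l + r) (sym i+r≡d) (shortest P (R ++ drop i i+r≡d (walk P)))) }
    where
    r = proj₁ (m≤n⇒∃[o]m+o≡n i≤d)
    i+r≡d = proj₂ (m≤n⇒∃[o]m+o≡n i≤d)

  geodesic-drop : ∀ {u v d} (P : Geodesic u v d) i {l} → i + l ≡ d → Geodesic (vtx (walk P) i) v l
  geodesic-drop P i {l} i+l≡d = record { walk = drop i i+l≡d (walk P) ; shortest = λ {r} R →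
    +-cancelˡ-≤ i l r (subst (_≤ i + r) (sym i+l≡d) (shortest P (take i i≤d (walk P) ++ R))) }
    where
    i≤d = subst (i ≤_) i+l≡d (m≤m+n i l)

  geodesic-vtx-injective : ∀ {z s t d d′} (P : Geodesic z s d) (Q : Geodesic z t d′) {i j} →
                           i ≤ d → j ≤ d′ → vtx (walk P) i ≡ vtx (walk Q) j → i ≡ j
  geodesic-vtx-injective P Q {i} {j} i≤d j≤d′ Pi≡Qj = geodesic-length-unique (geodesic-take P i i≤d)
    (subst (λ x → Geodesic _ x j) (sym Pi≡Qj) (geodesic-take Q j j≤d′))

  geodesic-step-≤ : ∀ {z u v x y} → Geodesic z u x → u ~ v → Geodesic z v y → y ≤ suc x
  geodesic-step-≤ P u~v Q = shortest Q (walk P ▻ u~v)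

  toWalk : ∀ {u v k} → Walk′ u v k → Walk G u v k
  toWalk {k = k} W = record
    { vtx   = vtx W ∘ toℕ
    ; start = start W
    ; end   = trans (cong (vtx W) (toℕ-fromℕ k)) (end W)
    ; step  = λ i → subst (λ x → vtx W x ~ vtx W (suc (toℕ i))) (sym (toℕ-inject₁ i))
                      (step W (toℕ i) (toℕ<n i)) }

  module _ {u v k} (P : Walk G u v k) where
    private
      vtxℕ : ℕ → Fin n
      vtxℕ x with x <? suc k
      ... | yes x<1+k = Walk.vtx P (fromℕ< x<1+k)
      ... | no _      = u

      vtxℕ-toℕ : ∀ i → vtxℕ (toℕ i) ≡ Walk.vtx P i
      vtxℕ-toℕ i with toℕ i <? suc k
      ... | yes i<1+k = cong (Walk.vtx P) (fromℕ<-toℕ i i<1+k)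
      ... | no  i≮1+k = contradiction (toℕ<n i) i≮1+k

    fromWalk : Walk′ u v k
    fromWalk = record
      { vtx   = vtxℕ
      ; start = trans (vtxℕ-toℕ fzero) (Walk.start P)
      ; end   = trans (cong vtxℕ (sym (toℕ-fromℕ k))) (trans (vtxℕ-toℕ (fromℕ k)) (Walk.end P))
      ; step  = λ x x<k → let i = fromℕ< x<k in
          subst₂ (λ y z → vtxℕ y ~ vtxℕ z) (trans (toℕ-inject₁ i) (toℕ-fromℕ< x<k)) (cong suc (toℕ-fromℕ< x<k))
            (subst₂ _~_ (sym (vtxℕ-toℕ (inject₁ i))) (sym (vtxℕ-toℕ (fsuc i))) (Walk.step P i)) }

  Geodesic⇒Dist : ∀ {u v d} → Geodesic u v d → Dist G u v d
  Geodesic⇒Dist P = toWalk (walk P) , λ l R → shortest P (fromWalk R)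

  distance : Connected G → ∀ u v → ∃[ d ] Geodesic u v d
  distance connected u v = geodesic-exists _ (fromWalk (proj₂ (connected u v)))

  module _ {Col : Set} (c : EdgeColoring G Col) (vsr : VeryStrongRainbow G c) where
    open EdgeColoring c

    geodesic-rainbow : ∀ {u v d} (P : Geodesic u v d) {i j} → i < d → j < d → i ≢ j →
      col (vtx (walk P) i) (vtx (walk P) (suc i)) ≢ col (vtx (walk P) j) (vtx (walk P) (suc j))
    geodesic-rainbow {u} {v} {d} P {i} {j} i<d j<d i≢j =
      subst₂ _≢_ (edge-colour i<d) (edge-colour j<d)
        (vsr u v d (Geodesic⇒Dist P) (toWalk (walk P)) (fromℕ< i<d) (fromℕ< j<d)
             (i≢j ∘ λ eq → trans (sym (toℕ-fromℕ< i<d)) (trans (cong toℕ eq) (toℕ-fromℕ< j<d))))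
      where
      W = toWalk (walk P)
      edge-colour : ∀ {x} (x<d : x < d) → col (Walk.vtx W (inject₁ (fromℕ< x<d))) (Walk.vtx W (fsuc (fromℕ< x<d)))
                                          ≡ col (vtx (walk P) x) (vtx (walk P) (suc x))
      edge-colour x<d = cong₂ (λ y z → col (vtx (walk P) y) (vtx (walk P) z))
        (trans (toℕ-inject₁ _) (toℕ-fromℕ< x<d)) (cong suc (toℕ-fromℕ< x<d))

    -- The walk p q … a b then has length dist(p, b), so pq and ab are edges of one geodesic.
    geodesic-ends-colour-≢ : ∀ {p q a b α} → p ~ q → a ~ b → Geodesic q a α → Geodesic p b (2 + α) →
                             col p q ≢ col a b
    geodesic-ends-colour-≢ {p} {q} {a} {b} {α} p~q a~b Q P pq≡ab =
      geodesic-rainbow R (s≤s z≤n) ≤-refl (λ ()) (begin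
        col p (vtx W 1)                    ≡⟨ cong (col p) second ⟩
        col p q                            ≡⟨ pq≡ab ⟩
        col a b                            ≡⟨ sym (cong₂ col penultimate (end W)) ⟩
        col (vtx W (1 + α)) (vtx W (2 + α)) ∎)
      where
      open ≡-Reasoning
      W = p~q ◅ (walk Q ▻ a~b)
      R : Geodesic p b (2 + α)
      R = record { walk = W ; shortest = shortest P }
      second : vtx W 1 ≡ q
      second = trans (++-vtxˡ (walk Q) _ 0 z≤n) (start (walk Q))
      penultimate : vtx W (1 + α) ≡ a
      penultimate = trans (++-vtxˡ (walk Q) _ α ≤-refl) (end (walk Q))

  toℕ-next : ∀ {m} (i : Fin (suc m)) → toℕ i < m → toℕ (next G i) ≡ suc (toℕ i)
  toℕ-next {m} i i<m = trans (toℕ-fromℕ< (m%n<n (suc (toℕ i)) (suc m))) (m<n⇒m%n≡m (s≤s i<m))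

  toℕ-next-last : ∀ {m} (i : Fin (suc m)) → toℕ i ≡ m → toℕ (next G i) ≡ 0
  toℕ-next-last {m} i i≡m = trans (toℕ-fromℕ< (m%n<n (suc (toℕ i)) (suc m)))
                                  (trans (cong (λ j → suc j % suc m) i≡m) (n%n≡0 (suc m)))

  module _ {x y κ} (P : Walk′ x y (2 + κ)) (y~x : y ~ x)
           (injective : ∀ {i j} → i ≤ 2 + κ → j ≤ 2 + κ → vtx P i ≡ vtx P j → i ≡ j) where

    closeUp : Cycle G
    closeUp = record
      { k    = κ
      ; cyc  = vtx P ∘ toℕ
      ; inj  = λ {i} {j} → toℕ-injective ∘ injective (s≤s⁻¹ (toℕ<n i)) (s≤s⁻¹ (toℕ<n j))
      ; adjC = adjacent }
      where
      adjacent : ∀ i → vtx P (toℕ i) ~ vtx P (toℕ (next G i))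
      adjacent i with toℕ i <? 2 + κ
      ... | yes i<2+κ = subst (λ j → vtx P (toℕ i) ~ vtx P j) (sym (toℕ-next i i<2+κ)) (step P (toℕ i) i<2+κ)
      ... | no  i≮2+κ = subst₂ (λ j l → vtx P j ~ vtx P l) (sym i≡2+κ) (sym (toℕ-next-last i i≡2+κ))
                          (subst₂ _~_ (sym (end P)) (sym (start P)) y~x)
        where
        i≡2+κ = ≤-antisym (s≤s⁻¹ (toℕ<n i)) (≮⇒≥ i≮2+κ)

    closeUp-step : ∀ i → i < 2 + κ → EdgeOf G closeUp (vtx P i) (vtx P (suc i))
    closeUp-step i i<2+κ = fromℕ< i<3+κ , inj₁ (cong (vtx P) (toℕ-fromℕ< i<3+κ)
      , cong (vtx P) (trans (toℕ-next _ (subst (_< 2 + κ) (sym (toℕ-fromℕ< i<3+κ)) i<2+κ))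
                            (cong suc (toℕ-fromℕ< i<3+κ))))
      where
      i<3+κ = m<n⇒m<1+n i<2+κ

    closeUp-closing : EdgeOf G closeUp y x
    closeUp-closing = fromℕ (2 + κ) , inj₁ (trans (cong (vtx P) (toℕ-fromℕ _)) (end P)
                                           , trans (cong (vtx P) (toℕ-next-last _ (toℕ-fromℕ _))) (start P))

  module Glue {p q s t α₁ α₂ κ} (P : Geodesic p s α₁) (Q : Geodesic q t α₂)
              (s~t : s ~ t) (q~p : q ~ p) (α₁+α₂≡1+κ : α₁ + α₂ ≡ suc κ)
              (disjoint : ∀ {i j} → i ≤ α₁ → j ≤ α₂ → vtx (walk P) i ≢ vtx (walk Q) j) where
    private
      L : ℕ
      L = suc (α₁ + α₂)

      f : ℕ → Fin n
      f x with x ≤? α₁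
      ... | yes _ = vtx (walk P) x
      ... | no _  = vtx (walk Q) (L ∸ x)

      f-P : ∀ {x} → x ≤ α₁ → f x ≡ vtx (walk P) x
      f-P {x} x≤α₁ with x ≤? α₁
      ... | yes _   = refl
      ... | no x≰α₁ = contradiction x≤α₁ x≰α₁

      f-Q : ∀ {x} → α₁ < x → f x ≡ vtx (walk Q) (L ∸ x)
      f-Q {x} α₁<x with x ≤? α₁
      ... | yes x≤α₁ = contradiction x≤α₁ (<⇒≱ α₁<x)
      ... | no _     = refl

      L∸x≤α₂ : ∀ {x} → α₁ < x → L ∸ x ≤ α₂
      L∸x≤α₂ {x} α₁<x = subst (L ∸ x ≤_) (m+n∸m≡n α₁ α₂) (∸-monoʳ-≤ L α₁<x)

      f-step : ∀ x → x < L → f x ~ f (suc x)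
      f-step x x<L with <-cmp x α₁
      ... | tri< x<α₁ _ _ = subst₂ _~_ (sym (f-P (<⇒≤ x<α₁))) (sym (f-P x<α₁)) (step (walk P) x x<α₁)
      ... | tri≈ _ refl _ = subst₂ _~_ (sym (trans (f-P ≤-refl) (end (walk P))))
          (sym (trans (f-Q ≤-refl) (trans (cong (vtx (walk Q)) (m+n∸m≡n α₁ α₂)) (end (walk Q))))) s~t
      ... | tri> _ _ α₁<x = subst₂ _~_ (sym (trans (f-Q α₁<x) (cong (vtx (walk Q)) L∸x≡1+L∸[1+x])))
                                       (sym (f-Q (m<n⇒m<1+n α₁<x)))
                                       (~-sym (step (walk Q) (L ∸ suc x)
                                                (subst (_≤ α₂) L∸x≡1+L∸[1+x] (L∸x≤α₂ α₁<x))))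
        where
        L∸x≡1+L∸[1+x] : L ∸ x ≡ suc (L ∸ suc x)
        L∸x≡1+L∸[1+x] = +-∸-assoc 1 (s≤s⁻¹ x<L)

      glued : Walk′ p q (2 + κ)
      glued = cast (cong suc α₁+α₂≡1+κ) (record
        { vtx   = f
        ; start = trans (f-P z≤n) (start (walk P))
        ; end   = trans (f-Q (s≤s (m≤m+n α₁ α₂))) (trans (cong (vtx (walk Q)) (n∸n≡0 L)) (start (walk Q)))
        ; step  = f-step })

      glued-injective : ∀ {x y} → x ≤ 2 + κ → y ≤ 2 + κ → f x ≡ f y → x ≡ y
      glued-injective {x} {y} x≤ y≤ fx≡fy with ≤-<-connex x α₁ | ≤-<-connex y α₁
      ... | inj₁ x≤α₁ | inj₁ y≤α₁ = geodesic-vtx-injective P P x≤α₁ y≤α₁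
                                    (trans (sym (f-P x≤α₁)) (trans fx≡fy (f-P y≤α₁)))
      ... | inj₁ x≤α₁ | inj₂ α₁<y = contradiction (trans (sym (f-P x≤α₁)) (trans fx≡fy (f-Q α₁<y)))
                                      (disjoint x≤α₁ (L∸x≤α₂ α₁<y))
      ... | inj₂ α₁<x | inj₁ y≤α₁ = contradiction (trans (sym (f-P y≤α₁)) (trans (sym fx≡fy) (f-Q α₁<x)))
                                      (disjoint y≤α₁ (L∸x≤α₂ α₁<x))
      ... | inj₂ α₁<x | inj₂ α₁<y = ∸-cancelˡ-≡ (≤-L x≤) (≤-L y≤)
          (geodesic-vtx-injective Q Q (L∸x≤α₂ α₁<x) (L∸x≤α₂ α₁<y)
            (trans (sym (f-Q α₁<x)) (trans fx≡fy (f-Q α₁<y))))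
        where
        ≤-L : ∀ {z} → z ≤ 2 + κ → z ≤ L
        ≤-L {z} = subst (z ≤_) (cong suc (sym α₁+α₂≡1+κ))

    cycle : Cycle G
    cycle = closeUp glued q~p glued-injective

    cycle-∋-st : EdgeOf G cycle s t
    cycle-∋-st = subst₂ (EdgeOf G cycle)
      (trans (f-P ≤-refl) (end (walk P)))
      (trans (f-Q ≤-refl) (trans (cong (vtx (walk Q)) (m+n∸m≡n α₁ α₂)) (end (walk Q))))
      (closeUp-step glued q~p glued-injective α₁ (subst (α₁ <_) (cong suc α₁+α₂≡1+κ) (s≤s (m≤m+n α₁ α₂))))

    cycle-∋-qp : EdgeOf G cycle q p
    cycle-∋-qp = closeUp-closing glued q~p glued-injective

  odd-3+ρ+ρ : ∀ ρ → Odd G (3 + (ρ + ρ))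
  odd-3+ρ+ρ ρ = suc ρ , identity ρ
    where
    identity : ∀ ρ → 3 + (ρ + ρ) ≡ suc (2 * suc ρ)
    identity = solve-∀

  record Fork {z s t m} (S : Geodesic z s m) (T : Geodesic z t m) : Set where
    field
      k            : ℕ
      k<m          : k < m
      agree        : vtx (walk S) k ≡ vtx (walk T) k
      diverge      : vtx (walk S) (suc k) ≢ vtx (walk T) (suc k)
      cycle        : Cycle G
      odd          : Odd G (len G cycle)
      cycle-∋-st   : EdgeOf G cycle s t
      cycle-∋-fork : EdgeOf G cycle (vtx (walk T) (suc k)) (vtx (walk S) k)

  -- From their last common vertex, S and T reach the two ends of st at equal
  -- distance, so together with st they bound a cycle of odd length.
  fork : ∀ {z s t m} → s ~ t → (S : Geodesic z s m) (T : Geodesic z t m) → Fork S T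
  fork {z} {s} {t} {m} s~t S T =
    from-last-agreement (greatest≤ Agree (λ i → Sᵢ i ≟ Tᵢ i) (trans (start (walk S)) (sym (start (walk T)))) m)
    where
    Sᵢ = vtx (walk S)
    Tᵢ = vtx (walk T)
    Agree : ℕ → Set
    Agree i = Sᵢ i ≡ Tᵢ i

    from-last-agreement : ∃[ k ] (k ≤ m × Agree k × (∀ {i} → k < i → i ≤ m → ¬ Agree i)) → Fork S T
    from-last-agreement (k , k≤m , agree , above) with m≤n⇒m<n∨m≡n k≤m
    ... | inj₂ k≡m = ⊥-elim (~-irrefl s~t (trans (sym (end (walk S)))
                                          (trans (subst Agree k≡m agree) (end (walk T)))))
    ... | inj₁ k<m = record
      { k = k ; k<m = k<m ; agree = agree ; diverge = above ≤-refl k<m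
      ; cycle = Glue.cycle P Q s~t q~p refl disjoint
      ; odd = odd-3+ρ+ρ ρ
      ; cycle-∋-st = Glue.cycle-∋-st P Q s~t q~p refl disjoint
      ; cycle-∋-fork = Glue.cycle-∋-qp P Q s~t q~p refl disjoint }
      where
      ρ = proj₁ (m≤n⇒∃[o]m+o≡n k<m)
      1+k+ρ≡m : suc k + ρ ≡ m
      1+k+ρ≡m = proj₂ (m≤n⇒∃[o]m+o≡n k<m)
      k+1+ρ≡m : k + suc ρ ≡ m
      k+1+ρ≡m = trans (+-suc k ρ) 1+k+ρ≡m
      P = geodesic-drop S k k+1+ρ≡m
      Q = geodesic-drop T (suc k) 1+k+ρ≡m
      q~p : Tᵢ (suc k) ~ Sᵢ k
      q~p = subst (Tᵢ (suc k) ~_) (sym agree) (~-sym (step (walk T) k k<m))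
      disjoint : ∀ {i j} → i ≤ suc ρ → j ≤ ρ → Sᵢ (k + i) ≢ Tᵢ (suc k + j)
      disjoint {i} {j} i≤1+ρ j≤ρ Sᵢ≡Tⱼ = above k<k+i k+i≤m (trans Sᵢ≡Tⱼ (cong Tᵢ (sym k+i≡1+k+j)))
        where
        k+i≤m = ≤-trans (+-monoʳ-≤ k i≤1+ρ) (≤-reflexive k+1+ρ≡m)
        k+i≡1+k+j : k + i ≡ suc k + j
        k+i≡1+k+j = geodesic-vtx-injective S T k+i≤m (≤-trans (+-monoʳ-≤ (suc k) j≤ρ) (≤-reflexive 1+k+ρ≡m)) Sᵢ≡Tⱼ
        k<k+i : k < k + i
        k<k+i = subst (k <_) (sym k+i≡1+k+j) (s≤s (m≤m+n k j))

  EdgeOf-sym : ∀ C {x y} → EdgeOf G C x y → EdgeOf G C y x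
  EdgeOf-sym C (i , inj₁ (x≡ , y≡)) = i , inj₂ (x≡ , y≡)
  EdgeOf-sym C (i , inj₂ (y≡ , x≡)) = i , inj₁ (y≡ , x≡)

  EdgeOf⇒OnCycleˡ : ∀ C {x y} → EdgeOf G C x y → OnCycle G C x
  EdgeOf⇒OnCycleˡ C (i , inj₁ (x≡ , _)) = i , x≡
  EdgeOf⇒OnCycleˡ C (i , inj₂ (_ , x≡)) = next G i , x≡

  EdgeOf⇒OnCycleʳ : ∀ C {x y} → EdgeOf G C x y → OnCycle G C y
  EdgeOf⇒OnCycleʳ C = EdgeOf⇒OnCycleˡ C ∘ EdgeOf-sym C

  SameCycle-sym : ∀ {C D} → SameCycle G C D → SameCycle G D C
  SameCycle-sym C≈D x y = proj₂ (C≈D x y) , proj₁ (C≈D x y)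

  SameCycle⇒len≤ : ∀ {C D} → SameCycle G C D → len G C ≤ len G D
  SameCycle⇒len≤ {C} {D} C≈D = injective⇒≤ {f = proj₁ ∘ position} λ {i} {j} eq →
    Cycle.inj C (trans (sym (proj₂ (position i))) (trans (cong (Cycle.cyc D) eq) (proj₂ (position j))))
    where
    position : ∀ i → OnCycle G D (Cycle.cyc C i)
    position i = EdgeOf⇒OnCycleˡ D (proj₁ (C≈D _ _) (i , inj₁ (refl , refl)))

  SameCycle⇒len≡ : ∀ {C D} → SameCycle G C D → len G C ≡ len G D
  SameCycle⇒len≡ {C} {D} C≈D = ≤-antisym (SameCycle⇒len≤ {C} {D} C≈D) (SameCycle⇒len≤ {D} {C} (SameCycle-sym {C} {D} C≈D))

  Even⇒¬Odd : ∀ {m} → Even G m → ¬ Odd G m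
  Even⇒¬Odd (j , m≡2j) (k , m≡1+2k) = even≢odd j k (trans (sym m≡2j) m≡1+2k)

  deg≡2⇒¬3-neighbours : ∀ {v x y z} → deg G v ≡ 2 → v ~ x → v ~ y → v ~ z → x ≢ y → x ≢ z → y ≢ z → ⊥
  deg≡2⇒¬3-neighbours {v} deg≡2 v~x v~y v~z =
    length≡2⇒¬3-distinct deg≡2 (neighbour v~x) (neighbour v~y) (neighbour v~z)
    where
    neighbour : ∀ {x} → v ~ x → x ∈ filterᵇ (Graph.adj G v) (allFin n)
    neighbour {x} v~x = ∈-filter⁺ (T? ∘ Graph.adj G v) (∈-allFin x) (subst T (sym v~x) tt)

  degree-2-branch⇒source : ∀ {z s t m m′} (S : Geodesic z s m) (T : Geodesic z t m′) {k} → k < m → k < m′ →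
    vtx (walk S) k ≡ vtx (walk T) k → vtx (walk S) (suc k) ≢ vtx (walk T) (suc k) →
    deg G (vtx (walk S) k) ≡ 2 → k ≡ 0
  degree-2-branch⇒source S T {zero}  _ _ _ _ _ = refl
  degree-2-branch⇒source S T {suc k} k<m k<m′ agree diverge deg≡2 =
    ⊥-elim (deg≡2⇒¬3-neighbours deg≡2 back forth forth′
      (λ eq → <⇒≢ k<2+k (geodesic-vtx-injective S S k≤m k<m eq))
      (λ eq → <⇒≢ k<2+k (geodesic-vtx-injective S T k≤m k<m′ eq))
      diverge)
    where
    Sᵢ = vtx (walk S)
    k<2+k = m<n⇒m<1+n (n<1+n k)
    k≤m = ≤-trans (<⇒≤ k<2+k) k<m
    back : Sᵢ (suc k) ~ Sᵢ k
    back = ~-sym (step (walk S) k (<⇒≤ k<m))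
    forth : Sᵢ (suc k) ~ Sᵢ (2 + k)
    forth = step (walk S) (suc k) k<m
    forth′ : Sᵢ (suc k) ~ vtx (walk T) (2 + k)
    forth′ = subst (_~ vtx (walk T) (2 + k)) (sym agree) (step (walk T) (suc k) k<m′)

  OddCycleFree : Fin n → Fin n → Set
  OddCycleFree p q = ∀ C → EdgeOf G C p q → ¬ Odd G (len G C)

  OddCycleFree-sym : ∀ {p q} → OddCycleFree p q → OddCycleFree q p
  OddCycleFree-sym free C = free C ∘ EdgeOf-sym C

  Bridge⊎InEvenCycle⇒OddCycleFree : Cactus G → ∀ {p q} → Bridge G p q ⊎ InEvenCycle G p q → OddCycleFree p q
  Bridge⊎InEvenCycle⇒OddCycleFree cactus (inj₁ (_ , acyclic)) C C∋pq _ = acyclic C C∋pq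
  Bridge⊎InEvenCycle⇒OddCycleFree cactus {p} {q} (inj₂ (p~q , D , D-even , D∋pq)) C C∋pq =
    Even⇒¬Odd (subst (Even G) (SameCycle⇒len≡ {D} {C} (cactus p q p~q D C D∋pq C∋pq)) D-even)

  OddCycleFree⇒dist-differ : ∀ {p q s x y} → p ~ q → OddCycleFree p q → Geodesic p s x → Geodesic q s y →
                             x ≡ suc y ⊎ y ≡ suc x
  OddCycleFree⇒dist-differ p~q free P Q
    with within-one (geodesic-step-≤ (geodesic-reverse Q) (~-sym p~q) (geodesic-reverse P))
                    (geodesic-step-≤ (geodesic-reverse P) p~q (geodesic-reverse Q))
  ... | inj₁ x≡1+y        = inj₁ x≡1+y
  ... | inj₂ (inj₂ y≡1+x) = inj₂ y≡1+x
  ... | inj₂ (inj₁ refl)  = ⊥-elim (free (Fork.cycle F) (Fork.cycle-∋-st F) (Fork.odd F))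
    where
    F = fork p~q (geodesic-reverse P) (geodesic-reverse Q)

  module _ (connected : Connected G) (cactus : Cactus G) {a b} (a~b : a ~ b)
           (C : Cycle G) (C-odd : Odd G (len G C)) (C∋ab : EdgeOf G C a b)
           (w : Fin n) (w-opposite : IsVopp G C a b w) (deg-w : deg G w ≡ 2) where

    equidistant⇒opposite : ∀ {z m} → Geodesic z a m → Geodesic z b m → z ≡ w
    equidistant⇒opposite {z} {m} A B = begin
      z              ≡⟨ sym (start (walk A)) ⟩
      vtx (walk A) 0 ≡⟨ cong (vtx (walk A)) (sym k≡0) ⟩
      vtx (walk A) k ≡⟨ fork≡w ⟩
      w              ∎
      where
      open ≡-Reasoning
      open Fork (fork a~b A B)
      r = proj₁ (m≤n⇒∃[o]m+o≡n (<⇒≤ k<m))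
      k+r≡m = proj₂ (m≤n⇒∃[o]m+o≡n (<⇒≤ k<m))
      fork-equidistant : Equidistant G (vtx (walk A) k) a b
      fork-equidistant = r , Geodesic⇒Dist (geodesic-drop A k k+r≡m)
        , Geodesic⇒Dist (subst (λ x → Geodesic x b r) (sym agree) (geodesic-drop B k k+r≡m))
      fork-on-C : OnCycle G C (vtx (walk A) k)
      fork-on-C = EdgeOf⇒OnCycleʳ C (proj₁ (cactus a b a~b cycle C cycle-∋-st C∋ab _ _) cycle-∋-fork)
      fork≡w : vtx (walk A) k ≡ w
      fork≡w = proj₂ (proj₂ w-opposite) _ fork-on-C fork-equidistant
      k≡0 : k ≡ 0
      k≡0 = degree-2-branch⇒source A B k<m k<m agree diverge (subst (λ x → deg G x ≡ 2) (sym fork≡w) deg-w)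

    crossing-impossible : ∀ {p q α} → p ~ q → OddCycleFree p q → Geodesic p b α → Geodesic q a α →
                          Geodesic p a (suc α) → Geodesic q b (suc α) → ⊥
    crossing-impossible {α = zero} p~q free Pb Qa _ _ = free C (subst₂ (EdgeOf G C) b≡p a≡q (EdgeOf-sym C C∋ab)) C-odd
      where
      b≡p = trans (sym (end (walk Pb))) (start (walk Pb))
      a≡q = trans (sym (end (walk Qa))) (start (walk Qa))
    crossing-impossible {p} {q} {suc ρ} p~q free Pb Qa Pa Qb = free C (EdgeOf-sym C C∋qp) C-odd
      where
      α = suc ρ
      -- A common vertex would give walks p → a and q → b of total length 2α.
      disjoint : ∀ {i j} → i ≤ α → j ≤ α → vtx (walk Pb) i ≢ vtx (walk Qa) j
      disjoint {i} {j} i≤α j≤α Pᵢ≡Qⱼ = ¬-both-detours {i = i} {j} i+i′≡α j+j′≡α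
        (shortest Pa (take i i≤α (walk Pb) ++ startAt Pᵢ≡Qⱼ (drop j j+j′≡α (walk Qa))))
        (shortest Qb (take j j≤α (walk Qa) ++ startAt (sym Pᵢ≡Qⱼ) (drop i i+i′≡α (walk Pb))))
        where
        i+i′≡α = proj₂ (m≤n⇒∃[o]m+o≡n i≤α)
        j+j′≡α = proj₂ (m≤n⇒∃[o]m+o≡n j≤α)
      open Glue Pb Qa (~-sym a~b) (~-sym p~q) refl disjoint
      C∋qp : EdgeOf G C q p
      C∋qp = proj₁ (cactus a b a~b cycle C (EdgeOf-sym cycle cycle-∋-st) C∋ab q p) cycle-∋-qp

    module _ {Col : Set} (c : EdgeColoring G Col) (vsr : VeryStrongRainbow G c) where
      open EdgeColoring c

      farther-from-a⇒colour-≢ : ∀ {p q α} → p ~ q → OddCycleFree p q → Geodesic p a (suc α) → Geodesic q a α →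
                                col p q ≢ col a b
      farther-from-a⇒colour-≢ {p} {q} {α} p~q free Pa Qa with distance connected p b | distance connected q b
      ... | Bp , Pb | Bq , Qb with OddCycleFree⇒dist-differ p~q free Pb Qb
      ...   | inj₂ Bq≡1+Bp = ⊥-elim (crossing-impossible p~q free (subst (Geodesic p b) Bp≡α Pb) Qa Pa
                                       (subst (Geodesic q b) (trans Bq≡1+Bp (cong suc Bp≡α)) Qb))
        where
        Bp≡α : Bp ≡ α
        Bp≡α = suc-injective (≤-antisym (subst (_≤ suc α) Bq≡1+Bp (geodesic-step-≤ Qa a~b Qb))
                                        (geodesic-step-≤ Pb (~-sym a~b) Pa))
      ...   | inj₁ Bp≡1+Bq with within-one (geodesic-step-≤ Qa a~b Qb) (geodesic-step-≤ Qb (~-sym a~b) Qa)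
      ...     | inj₁ Bq≡1+α = geodesic-ends-colour-≢ c vsr p~q a~b Qa
                                (subst (Geodesic p b) (trans Bp≡1+Bq (cong suc Bq≡1+α)) Pb)
      ...     | inj₂ (inj₂ α≡1+Bq) = λ pq≡ab → geodesic-ends-colour-≢ c vsr p~q (~-sym a~b) Qb
                                       (subst (Geodesic p a) (cong suc α≡1+Bq) Pa) (trans pq≡ab (colSym a b))
      ...     | inj₂ (inj₁ Bq≡α) = ⊥-elim (~-irrefl p~q (trans p≡w (sym q≡w)))
        where
        q≡w = equidistant⇒opposite Qa (subst (Geodesic q b) Bq≡α Qb)
        p≡w = equidistant⇒opposite Pa (subst (Geodesic p b) (trans Bp≡1+Bq (cong suc Bq≡α)) Pb)

      OddCycleFree⇒colour-≢ : ∀ {p q} → p ~ q → OddCycleFree p q → col p q ≢ col a b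
      OddCycleFree⇒colour-≢ {p} {q} p~q free with distance connected p a | distance connected q a
      ... | Ap , Pa | Aq , Qa with OddCycleFree⇒dist-differ p~q free Pa Qa
      ...   | inj₁ Ap≡1+Aq = farther-from-a⇒colour-≢ p~q free (subst (Geodesic p a) Ap≡1+Aq Pa) Qa
      ...   | inj₂ Aq≡1+Ap = farther-from-a⇒colour-≢ (~-sym p~q) (OddCycleFree-sym free)
                               (subst (Geodesic q a) Aq≡1+Ap Qa) Pa ∘ trans (colSym q p)

lemma12 : (n : ℕ) (G : Graph n) → Connected G → Cactus G →
    (a₁ b₁ a₂ b₂ : Fin n) → Bridge G a₁ b₁ ⊎ InEvenCycle G a₁ b₁ → Erem G a₂ b₂ →
    {Col : Set} (c : EdgeColoring G Col) → VeryStrongRainbow G c →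
    EdgeColoring.col c a₁ b₁ ≢ EdgeColoring.col c a₂ b₂
lemma12 n G connected cactus a₁ b₁ a₂ b₂ bridge⊎even (a₂~b₂ , C , C-odd , C∋a₂b₂ , w , w-opposite , deg-w) c vsr =
  OddCycleFree⇒colour-≢ G connected cactus a₂~b₂ C C-odd C∋a₂b₂ w w-opposite deg-w c vsr
    a₁~b₁ (Bridge⊎InEvenCycle⇒OddCycleFree G cactus bridge⊎even)
  where
  a₁~b₁ : Adj G a₁ b₁
  a₁~b₁ = [ proj₁ , proj₁ ]′ bridge⊎even
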